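{- Let $n\ge1$ with binary expansion $\beta(n)=b_1\cdots b_k$. If $n=2^k-1$, then $\hat0(n)=\hat1(n)=1^k$. Otherwise, if the principal prefix of $\beta(n)$ is $b_1\cdots b_r$, then $$\hat0(n)=0\,(b_2+1)\cdots(b_r+1)\,2\,1^{k-r-1}.$$
   Context: $\beta(n)=b_1\cdots b_k$ has $b_1=1$ most significant. A hyperbinary expansion of $n$ is a word $d_1\cdots d_k$ of length $k$ over $\{0,1,2\}$ with $\sum_i d_i2^{k-i}=n$; it corresponds to the hyperbinary partition of $n$ (partition into powers of $2$, each part at most twice) in which $2^{k-i}$ has multiplicity $d_i$. $\mathcal{D}(n)$ is the set of hyperbinary expansions ordered by transporting refinement of partitions ($\mu\le\lambda$ if the parts of $\lambda$ can be subdivided to produce the parts of $\mu$). It is known that $\mathcal{D}(n)$ has a maximum $\hat1(n)$ and a minimum $\hat0(n)$. The principal prefix of $\beta(n)$ is $b_1\cdots b_r$ where $b_{r+1}$ is the rightmost $0$ in $\beta(n)$. Exponents denote repetition: $1^m$ is $m$ ones. -}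

module Defs where

open import Data.Nat using (ℕ; zero; suc; _+_; _*_; _^_; _≤_; _/_; _%_)
open import Data.List using (List; []; _∷_; _++_; [_]; length; replicate; concat; foldl)
open import Data.Nat.ListAction using (sum)
open import Data.List.Relation.Unary.All using (All)
open import Data.List.Relation.Binary.Pointwise using (Pointwise)
open import Data.List.Relation.Binary.Permutation.Propositional using (_↭_)
open import Data.Product using (Σ; _×_)
open import Relation.Binary.PropositionalEquality using (_≡_)

-- Words are lists of digits, most significant digit first.
Word : Set
Word = List ℕ

value : Word → ℕ
value = foldl (λ acc d → 2 * acc + d) 0

-- binary digits of m, most significant first; the first argument is fuel
bitsAux : ℕ → ℕ → Word
bitsAux zero    _       = []
bitsAux (suc f) zero    = []
bitsAux (suc f) (suc m) = bitsAux f (suc m / 2) ++ [ suc m % 2 ]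

β : ℕ → Word
β n = bitsAux n n

IsHyperbinary : ℕ → Word → Set
IsHyperbinary n d = (length d ≡ length (β n)) × All (_≤ 2) d × (value d ≡ n)

parts : Word → List ℕ
parts []       = []
parts (x ∷ xs) = replicate x (2 ^ length xs) ++ parts xs

-- refinement of partitions (as multisets): μ ≤ λ iff the parts of λ can be
-- subdivided (part j of λ into the list Ls_j) to produce exactly the parts of μ
Refines : List ℕ → List ℕ → Set
Refines μ λ′ = Σ (List (List ℕ)) λ Ls →
  Pointwise (λ L p → sum L ≡ p) Ls λ′ × (concat Ls ↭ μ)

_≼_ : Word → Word → Set
d ≼ e = Refines (parts d) (parts e)

IsMin𝒟 : ℕ → Word → Set
IsMin𝒟 n w = IsHyperbinary n w × (∀ d → IsHyperbinary n d → w ≼ d)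

IsMax𝒟 : ℕ → Word → Set
IsMax𝒟 n w = IsHyperbinary n w × (∀ d → IsHyperbinary n d → d ≼ w)

-- Let d be a hyperbinary expansion of n.  Each suffix of d of length j is congruent
-- to the corresponding suffix of β(n) modulo 2^j and, having digits at most 2, is worth
-- less than 2^(j+1) - 1; so it is worth at most v + 2^j, where v is the value of the
-- binary suffix, and exactly v when that binary suffix is 1^j.  The word
-- 0 (b₂+1) ⋯ (b_r+1) 2 1^m attains all these bounds.  Whenever w and d have the same
-- value and every suffix of w is worth at least the corresponding suffix of d, the parts
-- of d can be carried down position by position, halving every part that is not kept,
-- and this refines d into w.  For n = 2^k - 1 the bound forces every expansion to be 1^k.

module Submission where

open import Defs
open import Data.Nat using (ℕ; zero; suc; _+_; _*_; _∸_; _^_; _≤_; _<_; _≥_; z≤n; s≤s; _/_; _%_; NonZero)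
open import Data.Nat.Properties
open import Data.Nat.DivMod using (m≡m%n+[m/n]*n; m%n<n; m/n≤m; m/n<m; m/n≡1+[m∸n]/n)
open import Data.Nat.Tactic.RingSolver using (solve-∀)
open import Data.List using (List; []; _∷_; _++_; [_]; length; replicate; map; drop; foldl)
open import Data.List.Properties using (foldl-++; length-replicate; ++-assoc)
open import Data.Nat.ListAction using (sum)
open import Data.Nat.ListAction.Properties using (sum-++)
open import Data.List.Relation.Binary.Pointwise using ([]; _∷_)
open import Data.List.Relation.Binary.Permutation.Propositional using (↭-refl)
import Data.List.Relation.Binary.Permutation.Propositional.Properties as ↭
import Relation.Binary.Reasoning.Base.Single as Reasoning
open import Data.List.Relation.Unary.All using (All; []; _∷_) renaming (map to All-map)
import Data.List.Relation.Unary.All.Properties as All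
open import Data.Product using (_×_; _,_; proj₁; proj₂; ∃-syntax)
open import Relation.Nullary using (yes; no)
open import Data.Empty using (⊥-elim)
open import Relation.Binary.PropositionalEquality using (_≡_; refl; sym; trans; cong; cong₂; subst; module ≡-Reasoning)

a*P+u≡b*P+v⇒u≡[b∸a]*P+v : ∀ {a b} P u v → a ≤ b → a * P + u ≡ b * P + v → u ≡ (b ∸ a) * P + v
a*P+u≡b*P+v⇒u≡[b∸a]*P+v {a} {b} P u v a≤b eq = +-cancelˡ-≡ (a * P) u ((b ∸ a) * P + v) (begin
  a * P + u                 ≡⟨ eq ⟩
  b * P + v                 ≡⟨ cong (λ c → c * P + v) (m+[n∸m]≡n a≤b) ⟨
  (a + (b ∸ a)) * P + v     ≡⟨ regroup a (b ∸ a) P v ⟩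
  a * P + ((b ∸ a) * P + v) ∎)
  where
  open ≡-Reasoning
  regroup : ∀ a t P v → (a + t) * P + v ≡ a * P + (t * P + v)
  regroup = solve-∀

a*P+u≡b*P+v∧v<P⇒a≤b : ∀ a b P u v → v < P → a * P + u ≡ b * P + v → a ≤ b
a*P+u≡b*P+v∧v<P⇒a≤b a b P u v v<P eq with a ≤? b
... | yes a≤b = a≤b
... | no a≰b  = ⊥-elim (<-irrefl refl (begin-strict
  b * P + v       <⟨ +-monoʳ-< (b * P) v<P ⟩
  b * P + P       ≡⟨ +-comm (b * P) P ⟩
  suc b * P       ≤⟨ *-monoˡ-≤ P (≰⇒> a≰b) ⟩
  a * P           ≤⟨ m≤m+n (a * P) u ⟩
  a * P + u       ≡⟨ eq ⟩
  b * P + v       ∎))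
  where open ≤-Reasoning

value-foldl : ∀ a ds → foldl (λ acc d → 2 * acc + d) a ds ≡ a * 2 ^ length ds + value ds
value-foldl a []       = sym (trans (+-identityʳ (a * 1)) (*-identityʳ a))
value-foldl a (d ∷ ds) = begin
  foldl _ (2 * a + d) ds                        ≡⟨ value-foldl (2 * a + d) ds ⟩
  (2 * a + d) * P + value ds                    ≡⟨ regroup a d P (value ds) ⟩
  a * (2 * P) + (d * P + value ds)              ≡⟨ cong (a * (2 * P) +_) (value-foldl d ds) ⟨
  a * (2 * P) + value (d ∷ ds)                  ∎
  where
  open ≡-Reasoning
  P : ℕ
  P = 2 ^ length ds
  regroup : ∀ a d P v → (2 * a + d) * P + v ≡ a * (2 * P) + (d * P + v)
  regroup = solve-∀

value-++ : ∀ ds es → value (ds ++ es) ≡ value ds * 2 ^ length es + value es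
value-++ ds es = trans (foldl-++ _ 0 ds es) (value-foldl (value ds) es)

value-∷ : ∀ d ds → value (d ∷ ds) ≡ d * 2 ^ length ds + value ds
value-∷ d = value-++ [ d ]

value-replicate-1 : ∀ m → 1 + value (replicate m 1) ≡ 2 ^ m
value-replicate-1 zero    = refl
value-replicate-1 (suc m) = begin
  1 + value (1 ∷ replicate m 1)               ≡⟨ cong (1 +_) (value-∷ 1 (replicate m 1)) ⟩
  1 + (1 * 2 ^ length (replicate m 1) + V)    ≡⟨ cong (λ k → 1 + (1 * 2 ^ k + V)) (length-replicate m) ⟩
  1 + (1 * 2 ^ m + V)                         ≡⟨ regroup (2 ^ m) V ⟩
  2 ^ m + (1 + V)                             ≡⟨ cong (2 ^ m +_) (value-replicate-1 m) ⟩
  2 ^ m + 2 ^ m                               ≡⟨ cong (2 ^ m +_) (+-identityʳ (2 ^ m)) ⟨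
  2 * 2 ^ m                                   ∎
  where
  open ≡-Reasoning
  V : ℕ
  V = value (replicate m 1)
  regroup : ∀ P v → 1 + (1 * P + v) ≡ P + (1 + v)
  regroup = solve-∀

value-bound : ∀ c ds → All (_≤ c) ds → c + value ds ≤ c * 2 ^ length ds
value-bound c []       []         = ≤-reflexive (trans (+-identityʳ c) (sym (*-identityʳ c)))
value-bound c (d ∷ ds) (d≤c ∷ ds≤c) = begin
  c + value (d ∷ ds)          ≡⟨ cong (c +_) (value-∷ d ds) ⟩
  c + (d * P + value ds)      ≡⟨ +-exchange c (d * P) (value ds) ⟩
  d * P + (c + value ds)      ≤⟨ +-mono-≤ (*-monoˡ-≤ P d≤c) (value-bound c ds ds≤c) ⟩
  c * P + c * P               ≡⟨ double c P ⟩
  c * (2 * P)                 ∎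
  where
  open ≤-Reasoning
  P : ℕ
  P = 2 ^ length ds
  +-exchange : ∀ c x v → c + (x + v) ≡ x + (c + v)
  +-exchange = solve-∀
  double : ∀ c P → c * P + c * P ≡ c * (2 * P)
  double = solve-∀

value<2^length : ∀ bs → All (_≤ 1) bs → value bs < 2 ^ length bs
value<2^length bs bs≤1 = ≤-trans (value-bound 1 bs bs≤1) (≤-reflexive (*-identityˡ _))

bitsAux-zero : ∀ f → bitsAux f 0 ≡ []
bitsAux-zero zero    = refl
bitsAux-zero (suc f) = refl

value-bitsAux : ∀ f m → m ≤ f → value (bitsAux f m) ≡ m
value-bitsAux f       zero    _         = cong value (bitsAux-zero f)
value-bitsAux (suc f) (suc m) (s≤s m≤f) = begin
  value (bitsAux f (suc m / 2) ++ [ suc m % 2 ])  ≡⟨ value-++ (bitsAux f (suc m / 2)) [ suc m % 2 ] ⟩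
  value (bitsAux f (suc m / 2)) * 2 + suc m % 2   ≡⟨ cong (λ k → k * 2 + suc m % 2) (value-bitsAux f (suc m / 2) half≤f) ⟩
  suc m / 2 * 2 + suc m % 2                       ≡⟨ +-comm (suc m / 2 * 2) (suc m % 2) ⟩
  suc m % 2 + suc m / 2 * 2                       ≡⟨ m≡m%n+[m/n]*n (suc m) 2 ⟨
  suc m                                           ∎
  where
  open ≡-Reasoning
  half≤f : suc m / 2 ≤ f
  half≤f = ≤-trans (≤-pred (m/n<m (suc m) 2 (s≤s (s≤s z≤n)))) m≤f

bitsAux-digits : ∀ f m → All (_≤ 1) (bitsAux f m)
bitsAux-digits zero    m       = []
bitsAux-digits (suc f) zero    = []
bitsAux-digits (suc f) (suc m) = All.++⁺ (bitsAux-digits f (suc m / 2)) (≤-pred (m%n<n (suc m) 2) ∷ [])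

bitsAux-head : ∀ f m → suc m ≤ f → ∃[ bs ] bitsAux f (suc m) ≡ 1 ∷ bs
bitsAux-head (suc zero)    zero    _ = [] , refl
bitsAux-head (suc (suc f)) zero    _ = [] , refl
bitsAux-head (suc f) (suc m) (s≤s m<f) with bitsAux-head f (m / 2) (≤-trans (s≤s (m/n≤m m 2)) m<f)
... | bs , eq = bs ++ [ suc (suc m) % 2 ] , cong (_++ [ suc (suc m) % 2 ]) (begin
  bitsAux f (suc (suc m) / 2)  ≡⟨ cong (bitsAux f) (m/n≡1+[m∸n]/n {suc (suc m)} {2} (s≤s (s≤s z≤n))) ⟩
  bitsAux f (suc (m / 2))      ≡⟨ eq ⟩
  1 ∷ bs                       ∎)
  where open ≡-Reasoning

value-β : ∀ n → value (β n) ≡ n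
value-β n = value-bitsAux n n ≤-refl

β-digits : ∀ n → All (_≤ 1) (β n)
β-digits n = bitsAux-digits n n

β-head : ∀ n → ∃[ bs ] β (suc n) ≡ 1 ∷ bs
β-head n = bitsAux-head (suc n) n ≤-refl

-- Refinement in which every part is split in place, so no permutation is involved.
infix 4 _⊑_

data _⊑_ : List ℕ → List ℕ → Set where
  []    : [] ⊑ []
  split : ∀ L {μ p ν} → sum L ≡ p → μ ⊑ ν → L ++ μ ⊑ p ∷ ν

⊑-refl : ∀ μ → μ ⊑ μ
⊑-refl []      = []
⊑-refl (p ∷ μ) = split [ p ] (+-identityʳ p) (⊑-refl μ)

⊑-++ : ∀ {μ₁ μ₂ ν₁ ν₂} → μ₁ ⊑ ν₁ → μ₂ ⊑ ν₂ → μ₁ ++ μ₂ ⊑ ν₁ ++ ν₂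
⊑-++           []                   r₂ = r₂
⊑-++ {μ₂ = μ₂} (split L {μ₁} eq r₁) r₂ = subst (_⊑ _) (sym (++-assoc L μ₁ μ₂)) (split L eq (⊑-++ r₁ r₂))

⊑-sum : ∀ {μ ν} → μ ⊑ ν → sum μ ≡ sum ν
⊑-sum []                  = refl
⊑-sum (split L {μ} eq r) = trans (sum-++ L μ) (cong₂ _+_ eq (⊑-sum r))

⊑-++⁻ : ∀ ν₁ {ν₂ μ} → μ ⊑ ν₁ ++ ν₂ → ∃[ μ₁ ] ∃[ μ₂ ] μ ≡ μ₁ ++ μ₂ × μ₁ ⊑ ν₁ × μ₂ ⊑ ν₂
⊑-++⁻ []                       r = [] , _ , refl , [] , r
⊑-++⁻ (p ∷ ν₁) (split L eq r) with ⊑-++⁻ ν₁ r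
... | μ₁ , μ₂ , refl , r₁ , r₂ = L ++ μ₁ , μ₂ , sym (++-assoc L μ₁ μ₂) , split L eq r₁ , r₂

⊑-trans : ∀ {μ ν κ} → μ ⊑ ν → ν ⊑ κ → μ ⊑ κ
⊑-trans r []             = r
⊑-trans r (split K eq s) with ⊑-++⁻ K r
... | μ₁ , μ₂ , refl , r₁ , r₂ = split μ₁ (trans (⊑-sum r₁) eq) (⊑-trans r₂ s)

⊑⇒Refines : ∀ {μ ν} → μ ⊑ ν → Refines μ ν
⊑⇒Refines []             = [] , [] , ↭-refl
⊑⇒Refines (split L eq r) with ⊑⇒Refines r
... | Ls , sums , perm = L ∷ Ls , eq ∷ sums , ↭.++⁺ˡ L perm

replicate-+ : ∀ a b (x : ℕ) → replicate (a + b) x ≡ replicate a x ++ replicate b x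
replicate-+ zero    b x = refl
replicate-+ (suc a) b x = cong (x ∷_) (replicate-+ a b x)

⊑-halves : ∀ c s → replicate (2 * c) s ⊑ replicate c (2 * s)
⊑-halves zero    s = []
⊑-halves (suc c) s =
  subst (_⊑ replicate (suc c) (2 * s)) (cong (λ k → replicate k s) (sym (*-suc 2 c)))
        (split (s ∷ s ∷ []) refl (⊑-halves c s))

module ⊑-Reasoning = Reasoning _⊑_ (λ {μ} → ⊑-refl μ) ⊑-trans

-- Only proper suffixes are compared; the leading digits are unconstrained.
infix 4 _≤ˢ_

data _≤ˢ_ : Word → Word → Set where
  []  : [] ≤ˢ []
  _∷_ : ∀ {x y ds ws} → value ds ≤ value ws → ds ≤ˢ ws → x ∷ ds ≤ˢ y ∷ ws

≤ˢ-refl : ∀ ws → ws ≤ˢ ws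
≤ˢ-refl []       = []
≤ˢ-refl (w ∷ ws) = ≤-refl ∷ ≤ˢ-refl ws

≤ˢ-length : ∀ {ds ws} → ds ≤ˢ ws → length ds ≡ length ws
≤ˢ-length []      = refl
≤ˢ-length (_ ∷ r) = cong suc (≤ˢ-length r)

carry-step : ∀ c y x {s u v} .{{_ : NonZero s}} → v ≤ u → c * (2 * s) + (y * s + v) ≡ x * s + u →
             x ≤ 2 * c + y × (2 * c + y ∸ x) * s + v ≡ u
carry-step c y x {s} {u} {v} v≤u eq = x≤ , sym (a*P+u≡b*P+v⇒u≡[b∸a]*P+v s u v x≤ digits)
  where
  regroup : ∀ c s y v → c * (2 * s) + (y * s + v) ≡ (2 * c + y) * s + v
  regroup = solve-∀
  digits : x * s + u ≡ (2 * c + y) * s + v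
  digits = trans (sym eq) (regroup c s y v)
  x≤ : x ≤ 2 * c + y
  x≤ = *-cancelʳ-≤ x (2 * c + y) s (+-cancelʳ-≤ v (x * s) ((2 * c + y) * s)
         (≤-trans (+-monoʳ-≤ (x * s) v≤u) (≤-reflexive digits)))

-- The c extra parts are halved; of the 2 c + y parts of size 2 ^ length ds now
-- available, x are kept and the rest are carried down.  ds ≤ˢ ws is what makes x ≤ 2 c + y.
carry-⊑ : ∀ c {ds ws} → ds ≤ˢ ws → c * 2 ^ length ds + value ds ≡ value ws →
          parts ws ⊑ replicate c (2 ^ length ds) ++ parts ds
carry-⊑ zero    []                  _  = []
carry-⊑ (suc c) []                  ()
carry-⊑ c {y ∷ ds} {x ∷ ws} (ds≤ws ∷ r) eq = begin
  replicate x (2 ^ length ws) ++ parts ws            ≡⟨ cong (λ k → replicate x (2 ^ k) ++ parts ws) (≤ˢ-length r) ⟨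
  replicate x s ++ parts ws                          ∼⟨ ⊑-++ (⊑-refl (replicate x s)) (carry-⊑ e r e*s+ds≡ws) ⟩
  replicate x s ++ (replicate e s ++ parts ds)       ≡⟨ ++-replicate x e ⟩
  replicate (x + e) s ++ parts ds                    ≡⟨ cong (λ k → replicate k s ++ parts ds) (m+[n∸m]≡n x≤) ⟩
  replicate (2 * c + y) s ++ parts ds                ≡⟨ ++-replicate (2 * c) y ⟨
  replicate (2 * c) s ++ (replicate y s ++ parts ds) ∼⟨ ⊑-++ (⊑-halves c s) (⊑-refl (replicate y s ++ parts ds)) ⟩
  replicate c (2 * s) ++ (replicate y s ++ parts ds) ∎
  where
  open ⊑-Reasoning
  s : ℕ
  s = 2 ^ length ds
  instance
    s≢0 : NonZero s
    s≢0 = m^n≢0 2 (length ds)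
  digits : c * (2 * s) + (y * s + value ds) ≡ x * s + value ws
  digits = trans (cong (c * (2 * s) +_) (sym (value-∷ y ds)))
             (trans eq (trans (value-∷ x ws) (cong (λ k → x * 2 ^ k + value ws) (sym (≤ˢ-length r)))))
  x≤ : x ≤ 2 * c + y
  x≤ = proj₁ (carry-step c y x ds≤ws digits)
  e : ℕ
  e = 2 * c + y ∸ x
  e*s+ds≡ws : e * s + value ds ≡ value ws
  e*s+ds≡ws = proj₂ (carry-step c y x ds≤ws digits)
  ++-replicate : ∀ a b → replicate a s ++ (replicate b s ++ parts ds) ≡ replicate (a + b) s ++ parts ds
  ++-replicate a b = trans (sym (++-assoc (replicate a s) _ _)) (cong (_++ parts ds) (sym (replicate-+ a b s)))

record Congruent (ds bs : Word) : Set where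
  constructor congruent
  field
    quotient : ℕ
    value≡   : value ds ≡ quotient * 2 ^ length bs + value bs

Congruent-tail : ∀ {x y ds bs} → All (_≤ 1) bs → length ds ≡ length bs →
                 Congruent (x ∷ ds) (y ∷ bs) → Congruent ds bs
Congruent-tail {x} {y} {ds} {bs} bs≤1 len (congruent t eq) =
  congruent (y + 2 * t ∸ x) (a*P+u≡b*P+v⇒u≡[b∸a]*P+v P (value ds) (value bs) x≤ digits)
  where
  P : ℕ
  P = 2 ^ length bs
  regroup : ∀ t y P v → t * (2 * P) + (y * P + v) ≡ (y + 2 * t) * P + v
  regroup = solve-∀
  digits : x * P + value ds ≡ (y + 2 * t) * P + value bs
  digits = begin
    x * P + value ds                   ≡⟨ cong (λ k → x * 2 ^ k + value ds) len ⟨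
    x * 2 ^ length ds + value ds       ≡⟨ value-∷ x ds ⟨
    value (x ∷ ds)                     ≡⟨ eq ⟩
    t * (2 * P) + value (y ∷ bs)       ≡⟨ cong (t * (2 * P) +_) (value-∷ y bs) ⟩
    t * (2 * P) + (y * P + value bs)   ≡⟨ regroup t y P (value bs) ⟩
    (y + 2 * t) * P + value bs         ∎
    where open ≡-Reasoning
  x≤ : x ≤ y + 2 * t
  x≤ = a*P+u≡b*P+v∧v<P⇒a≤b x (y + 2 * t) P (value ds) (value bs) (value<2^length bs bs≤1) digits

Congruent-≤ : ∀ {ds bs} → All (_≤ 2) ds → length ds ≡ length bs → Congruent ds bs →
              value ds ≤ 2 ^ length bs + value bs
Congruent-≤ {ds} {bs} ds≤2 len (congruent t eq) = begin
  value ds          ≡⟨ eq ⟩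
  t * P + value bs  ≤⟨ +-monoˡ-≤ (value bs) (*-monoˡ-≤ P t≤1) ⟩
  1 * P + value bs  ≡⟨ cong (_+ value bs) (*-identityˡ P) ⟩
  P + value bs      ∎
  where
  open ≤-Reasoning
  P : ℕ
  P = 2 ^ length bs
  t≤1 : t ≤ 1
  t≤1 = ≤-pred (*-cancelʳ-< P t 2 (begin-strict
    t * P             ≤⟨ m≤m+n (t * P) (value bs) ⟩
    t * P + value bs  ≡⟨ eq ⟨
    value ds          <⟨ m<n+m (value ds) (s≤s z≤n) ⟩
    2 + value ds      ≤⟨ value-bound 2 ds ds≤2 ⟩
    2 * 2 ^ length ds ≡⟨ cong (λ k → 2 * 2 ^ k) len ⟩
    2 * P             ∎))

Congruent-replicate-1 : ∀ {ds m} → All (_≤ 2) ds → length ds ≡ m → Congruent ds (replicate m 1) →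
                        value ds ≡ value (replicate m 1)
Congruent-replicate-1         _    _   (congruent zero eq) = eq
Congruent-replicate-1 {ds} {m} ds≤2 len (congruent (suc t) eq) = ⊥-elim (<-irrefl refl (begin-strict
  2 * P                        ≤⟨ m≤m+n (2 * P) (t * P) ⟩
  2 * P + t * P                <⟨ n<1+n (2 * P + t * P) ⟩
  suc (2 * P + t * P)          ≡⟨ cong (λ Q → suc (2 * Q + t * Q)) ones ⟨
  suc (2 * (1 + v) + t * (1 + v)) ≡⟨ regroup t v ⟩
  2 + (suc t * (1 + v) + v)    ≡⟨ cong (λ Q → 2 + (suc t * Q + v)) ones ⟩
  2 + (suc t * P + v)          ≡⟨ cong (λ k → 2 + (suc t * 2 ^ k + v)) (length-replicate m) ⟨
  2 + (suc t * 2 ^ length (replicate m 1) + v) ≡⟨ cong (2 +_) eq ⟨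
  2 + value ds                 ≤⟨ value-bound 2 ds ds≤2 ⟩
  2 * 2 ^ length ds            ≡⟨ cong (λ k → 2 * 2 ^ k) len ⟩
  2 * P                        ∎))
  where
  open ≤-Reasoning
  P v : ℕ
  P = 2 ^ m
  v = value (replicate m 1)
  ones : 1 + v ≡ P
  ones = value-replicate-1 m
  regroup : ∀ t v → suc (2 * (1 + v) + t * (1 + v)) ≡ 2 + (suc t * (1 + v) + v)
  regroup = solve-∀

≡-replicate-1 : ∀ m ds → All (_≤ 2) ds → length ds ≡ m → Congruent ds (replicate m 1) → ds ≡ replicate m 1
≡-replicate-1 zero    []       _              _   _ = refl
≡-replicate-1 (suc m) (x ∷ ds) (x≤2 ∷ ds≤2) len c
  with ≡-replicate-1 m ds ds≤2 (suc-injective len)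
         (Congruent-tail (All.replicate⁺ m ≤-refl) (trans (suc-injective len) (sym (length-replicate m))) c)
... | refl = cong (_∷ replicate m 1) (*-cancelʳ-≡ x 1 Q (+-cancelʳ-≡ v (x * Q) (1 * Q) (begin
  x * Q + v                    ≡⟨ value-∷ x (replicate m 1) ⟨
  value (x ∷ replicate m 1)    ≡⟨ Congruent-replicate-1 (x≤2 ∷ ds≤2) len c ⟩
  value (1 ∷ replicate m 1)    ≡⟨ value-∷ 1 (replicate m 1) ⟩
  1 * Q + v                    ∎)))
  where
  open ≡-Reasoning
  Q v : ℕ
  Q = 2 ^ length (replicate m 1)
  v = value (replicate m 1)
  instance
    Q≢0 : NonZero Q
    Q≢0 = m^n≢0 2 (length (replicate m 1))

-- When 1 ∷ q is the principal prefix of β n:  β n = 1 ∷ binTail q m  and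
-- 0̂(n) = 0 ∷ minTail q m.
binTail : List ℕ → ℕ → Word
binTail q m = q ++ 0 ∷ replicate m 1

minTail : List ℕ → ℕ → Word
minTail q m = map suc q ++ 2 ∷ replicate m 1

length-minTail : ∀ q m → length (minTail q m) ≡ length (binTail q m)
length-minTail []      m = refl
length-minTail (y ∷ q) m = cong suc (length-minTail q m)

value-minTail : ∀ q m → value (minTail q m) ≡ 2 ^ length (binTail q m) + value (binTail q m)
value-minTail []      m = value-∷ 2 (replicate m 1)
value-minTail (y ∷ q) m = begin
  value (suc y ∷ minTail q m)                      ≡⟨ value-∷ (suc y) (minTail q m) ⟩
  suc y * 2 ^ length (minTail q m) + value (minTail q m)
                                                   ≡⟨ cong₂ (λ k v → suc y * 2 ^ k + v) (length-minTail q m) (value-minTail q m) ⟩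
  suc y * P + (P + value (binTail q m))            ≡⟨ regroup y P (value (binTail q m)) ⟩
  2 * P + (y * P + value (binTail q m))            ≡⟨ cong (2 * P +_) (value-∷ y (binTail q m)) ⟨
  2 * P + value (y ∷ binTail q m)                  ∎
  where
  open ≡-Reasoning
  P : ℕ
  P = 2 ^ length (binTail q m)
  regroup : ∀ y P v → suc y * P + (P + v) ≡ 2 * P + (y * P + v)
  regroup = solve-∀

binTail-digits : ∀ {q} m → All (_≤ 1) q → All (_≤ 1) (binTail q m)
binTail-digits m q≤1 = All.++⁺ q≤1 (z≤n ∷ All.replicate⁺ m ≤-refl)

minTail-digits : ∀ {q} m → All (_≤ 1) q → All (_≤ 2) (minTail q m)
minTail-digits m q≤1 = All.++⁺ (All.map⁺ (All-map s≤s q≤1)) (≤-refl ∷ All.replicate⁺ m (s≤s z≤n))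

minTail-bound : ∀ q m {ds} → All (_≤ 2) ds → length ds ≡ length (binTail q m) →
                Congruent ds (binTail q m) → value ds ≤ value (minTail q m)
minTail-bound q m ds≤2 len c = ≤-trans (Congruent-≤ ds≤2 len c) (≤-reflexive (sym (value-minTail q m)))

minTail-dominates : ∀ q m {x y z ds} → All (_≤ 1) q → All (_≤ 2) ds → length ds ≡ length (binTail q m) →
                    Congruent (x ∷ ds) (y ∷ binTail q m) → x ∷ ds ≤ˢ z ∷ minTail q m
minTail-dominates q m {ds = ds} q≤1 ds≤2 len c = minTail-bound q m ds≤2 len c′ ∷ suffixes q q≤1 ds≤2 len c′
  where
  c′ : Congruent ds (binTail q m)
  c′ = Congruent-tail (binTail-digits m q≤1) len c
  suffixes : ∀ p {es} → All (_≤ 1) p → All (_≤ 2) es → length es ≡ length (binTail p m) →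
             Congruent es (binTail p m) → es ≤ˢ minTail p m
  suffixes (y ∷ p) {x ∷ es} (_ ∷ p≤1) (_ ∷ es≤2) len c = minTail-dominates p m p≤1 es≤2 (suc-injective len) c
  suffixes []      {x ∷ es} _         (_ ∷ es≤2) len c
    with ≡-replicate-1 m es es≤2 (trans (suc-injective len) (length-replicate m))
           (Congruent-tail (All.replicate⁺ m ≤-refl) (suc-injective len) c)
  ... | refl = ≤-refl ∷ ≤ˢ-refl (replicate m 1)

value-0∷minTail : ∀ q m → value (0 ∷ minTail q m) ≡ value (1 ∷ binTail q m)
value-0∷minTail q m = begin
  value (0 ∷ minTail q m)                               ≡⟨ value-∷ 0 (minTail q m) ⟩
  value (minTail q m)                                   ≡⟨ value-minTail q m ⟩
  2 ^ length (binTail q m) + value (binTail q m)        ≡⟨ cong (_+ value (binTail q m)) (*-identityˡ _) ⟨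
  1 * 2 ^ length (binTail q m) + value (binTail q m)    ≡⟨ value-∷ 1 (binTail q m) ⟨
  value (1 ∷ binTail q m)                               ∎
  where open ≡-Reasoning

0∷minTail-≼ : ∀ q m {ds} → All (_≤ 1) q → All (_≤ 2) ds → length ds ≡ suc (length (binTail q m)) →
              value ds ≡ value (1 ∷ binTail q m) → (0 ∷ minTail q m) ≼ ds
0∷minTail-≼ q m {x ∷ ds} q≤1 (_ ∷ ds≤2) len v =
  ⊑⇒Refines (carry-⊑ 0 (minTail-dominates q m q≤1 ds≤2 (suc-injective len) (congruent 0 v))
                         (trans v (sym (value-0∷minTail q m))))

0∷minTail-isMin : ∀ n q m → β n ≡ 1 ∷ binTail q m → IsMin𝒟 n (0 ∷ minTail q m)
0∷minTail-isMin n q m β≡ = (length≡ , z≤n ∷ minTail-digits m q≤1 , value≡) , minimal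
  where
  q≤1 : All (_≤ 1) q
  q≤1 with subst (All (_≤ 1)) β≡ (β-digits n)
  ... | _ ∷ bs≤1 = All.++⁻ˡ q bs≤1
  length≡ : suc (length (minTail q m)) ≡ length (β n)
  length≡ = trans (cong suc (length-minTail q m)) (cong length (sym β≡))
  value-1∷binTail : value (1 ∷ binTail q m) ≡ n
  value-1∷binTail = trans (cong value (sym β≡)) (value-β n)
  value≡ : value (0 ∷ minTail q m) ≡ n
  value≡ = trans (value-0∷minTail q m) value-1∷binTail
  minimal : ∀ ds → IsHyperbinary n ds → (0 ∷ minTail q m) ≼ ds
  minimal ds (len , ds≤2 , v) = 0∷minTail-≼ q m q≤1 ds≤2 (trans len (cong length β≡)) (trans v (sym value-1∷binTail))

β-principal : ∀ {n} p m → n ≥ 1 → β n ≡ p ++ 0 ∷ replicate m 1 → β n ≡ 1 ∷ binTail (drop 1 p) m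
β-principal {suc n} p m _ β≡ with β-head n
... | bs , β≡1∷bs with p | β≡ | trans (sym β≡1∷bs) β≡
...   | []    | _   | ()
...   | y ∷ q | β≡′ | refl = β≡′

replicate-1-isExtremal : ∀ n → n + 1 ≡ 2 ^ length (β n) →
  IsMin𝒟 n (replicate (length (β n)) 1) × IsMax𝒟 n (replicate (length (β n)) 1)
replicate-1-isExtremal n n+1≡ = (isHyperbinary , λ ds h → ≡⇒≼ (sym (unique ds h)))
                              , (isHyperbinary , λ ds h → ≡⇒≼ (unique ds h))
  where
  k : ℕ
  k = length (β n)
  ones : Word
  ones = replicate k 1
  value≡ : value ones ≡ n
  value≡ = +-cancelˡ-≡ 1 (value ones) n (trans (value-replicate-1 k) (trans (sym n+1≡) (+-comm n 1)))
  isHyperbinary : IsHyperbinary n ones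
  isHyperbinary = length-replicate k , All.replicate⁺ k (s≤s z≤n) , value≡
  unique : ∀ ds → IsHyperbinary n ds → ds ≡ ones
  unique ds (len , ds≤2 , v) = ≡-replicate-1 k ds ds≤2 len (congruent 0 (trans v (sym value≡)))
  ≡⇒≼ : ∀ {ds es} → ds ≡ es → ds ≼ es
  ≡⇒≼ {ds} refl = ⊑⇒Refines (⊑-refl (parts ds))

corollary3p3 : (n : ℕ) → n ≥ 1 →
    ((n + 1 ≡ 2 ^ length (β n)) →
        IsMin𝒟 n (replicate (length (β n)) 1) × IsMax𝒟 n (replicate (length (β n)) 1))
    × ((p : List ℕ) (m : ℕ) → β n ≡ p ++ (0 ∷ replicate m 1) →
        IsMin𝒟 n (0 ∷ (map suc (drop 1 p) ++ (2 ∷ replicate m 1))))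
corollary3p3 n n≥1 =
  replicate-1-isExtremal n ,
  λ p m β≡ → 0∷minTail-isMin n (drop 1 p) m (β-principal p m n≥1 β≡)
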